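{- For every integer $k \ge 2$ there exist infinitely many (pairwise non-isomorphic) connected $k$-regular graphs, each containing a unique longest cycle.
   Context: Graphs are finite and simple. -}

module Defs where

open import Data.Nat as ℕ using (ℕ; suc; _+_; _≤_; _<?_)
open import Data.Bool using (Bool; true; false; if_then_else_)
open import Data.Fin using (Fin; zero; suc; toℕ; fromℕ<)
open import Data.List using (List; map; allFin)
open import Data.Nat.ListAction using (sum)
open import Data.Product using (Σ; ∃; _×_; _,_)
open import Data.Sum using (_⊎_)
open import Function using (Injective)
open import Function.Bundles using (_⤖_; Bijection)
open import Relation.Binary.PropositionalEquality using (_≡_)
open import Relation.Nullary using (yes; no)

record Graph (n : ℕ) : Set where
  field
    adj    : Fin n → Fin n → Bool
    sym    : ∀ u v → adj u v ≡ adj v u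
    irrefl : ∀ v → adj v v ≡ false
open Graph public

degree : ∀ {n} → Graph n → Fin n → ℕ
degree {n} G u = sum (map (λ v → if adj G u v then 1 else 0) (allFin n))

Regular : ∀ {n} → ℕ → Graph n → Set
Regular k G = ∀ u → degree G u ≡ k

data Walk {n} (G : Graph n) : Fin n → Fin n → Set where
  here : ∀ {u} → Walk G u u
  step : ∀ {u w v} → adj G u w ≡ true → Walk G w v → Walk G u v

Connected : ∀ {n} → Graph n → Set
Connected G = ∀ u v → Walk G u v

next : ∀ {m} → Fin (suc m) → Fin (suc m)
next {m} i with toℕ i <? m
... | yes p = suc (fromℕ< p)
... | no _  = zero

record Cycle {n} (G : Graph n) : Set where
  field
    l      : ℕ
    vertex : Fin (3 + l) → Fin n
    inj    : Injective _≡_ _≡_ vertex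
    closed : ∀ i → adj G (vertex i) (vertex (next i)) ≡ true
open Cycle public

len : ∀ {n} {G : Graph n} → Cycle G → ℕ
len C = 3 + l C

CycleEdge : ∀ {n} {G : Graph n} → Cycle G → Fin n → Fin n → Set
CycleEdge C u v =
  ∃ λ i → (vertex C i ≡ u × vertex C (next i) ≡ v)
        ⊎ (vertex C i ≡ v × vertex C (next i) ≡ u)

SameCycle : ∀ {n} {G : Graph n} → Cycle G → Cycle G → Set
SameCycle C D = ∀ u v → (CycleEdge C u v → CycleEdge D u v)
                      × (CycleEdge D u v → CycleEdge C u v)

Longest : ∀ {n} {G : Graph n} → Cycle G → Set
Longest {G = G} C = ∀ (D : Cycle G) → len D ≤ len C

UniqueLongestCycle : ∀ {n} → Graph n → Set
UniqueLongestCycle G =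
  Σ (Cycle G) λ C → Longest C × (∀ D → Longest D → SameCycle C D)

Isomorphic : ∀ {n m} → Graph n → Graph m → Set
Isomorphic {n} {m} G H =
  Σ (Fin n ⤖ Fin m) λ φ →
    ∀ u v → adj G u v ≡ adj H (Bijection.to φ u) (Bijection.to φ v)

record SomeGraph : Set where
  constructor mkGraph
  field
    size  : ℕ
    graph : Graph size
open SomeGraph public

-- Glue m copies of a rooted graph H, whose root has degree k − 2 and whose other vertices have
-- degree k, at their roots along a cycle C_m (the rooted product of C_m and H): the result is
-- connected and k-regular. Each root separates its copy of H from the rest of the graph, and a
-- cycle passes through a vertex only once, so a cycle meeting the interior of a copy stays in that
-- copy and has length at most |H|. Every other cycle runs through roots only, i.e. along C_m, and
-- the only such cycle of length m is C_m itself; hence for m > |H| the ring of roots is the unique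
-- longest cycle. Different m give different orders m |H|. Suitable H exist for every k ≥ 2: a
-- single vertex (k = 2), a graph on six vertices (k = 3), and for k ≥ 4 an apex joined to k − 2
-- vertices which are all joined to every vertex of a (k − 1)-cycle.
module Submission where

open import Defs hiding (sym)

open import Data.Bool using (Bool; true; false; if_then_else_; _∧_; _∨_)
open import Data.Bool.Properties using (∨-comm; ∧-zeroʳ)
open import Data.Empty using (⊥; ⊥-elim)
open import Data.Fin using (Fin; zero; suc; toℕ; fromℕ; inject₁; _↑ˡ_; _↑ʳ_; splitAt; combine; remQuot; punchOut)
open import Data.Fin.Patterns using (0F; 1F; 2F; 3F; 4F; 5F)
open import Data.Fin.Properties
  using (_≟_; toℕ-injective; toℕ-fromℕ; toℕ-fromℕ<; toℕ-inject₁; toℕ<n; inject₁ℕ<; suc-injective; 0≢1+n;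
         remQuot-combine; combine-remQuot; combine-surjective; combine-injectiveˡ; splitAt-↑ˡ; splitAt-↑ʳ;
         punchOut-injective; injective⇒≤; cantor-schröder-bernstein; any?; all?; ¬∀⟶∃¬)
open import Data.Fin.Relation.Unary.Top using (view; ‵fromℕ; ‵inject₁)
open import Data.List using (tabulate)
open import Data.List.Properties using (map-tabulate)
open import Data.Nat using (ℕ; zero; suc; _+_; _*_; _≤_; _<_; _<?_; z≤n; s≤s; NonZero)
open import Data.Nat.DivMod using (_%_; _mod_; m%n<n; m<n⇒m%n≡m; n%n≡0; [m+n]%n≡m%n; %-distribˡ-+; m%n%n≡m%n)
import Data.Nat.ListAction as ListAction
open import Data.Nat.Properties
  using (+-0-commutativeMonoid; +-assoc; +-comm; +-identityʳ; +-cancelˡ-≡; *-cancelʳ-≡; <-irrefl; ≤-trans; <⇒≤;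
         <⇒≱; ≤-pred; ≤∧≢⇒<; m≤n+m; m≤m+n; m≤n⇒m≤1+n; ≤⇒≯; m≢1+n+m; 1+n≢n)
open import Data.Product as Product using (Σ; ∃; _×_; _,_; proj₁; proj₂; uncurry)
open import Data.Sum using (_⊎_; inj₁; inj₂)
open import Function using (_∘_; id; Injective)
open import Function.Bundles using (Bijection; mk⇔)
open import Function.Properties.Bijection using (sym-≡)
open import Relation.Binary.PropositionalEquality
  using (_≡_; _≢_; refl; sym; trans; cong; cong₂; subst; subst₂; module ≡-Reasoning)
open import Relation.Nullary using (¬_; Dec; yes; no; does; contradiction; ¬?; _×-dec_)
open import Relation.Nullary.Decidable using (dec-true; dec-false; does-⇔; decidable-stable)
open import Relation.Unary using (Decidable)

open import Algebra.Properties.CommutativeMonoid.Sum +-0-commutativeMonoid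
  using (sum; sum-syntax; sum-cong-≗; sum-replicate-zero; ∑-distrib-+)

-- Counting

iverson : Bool → ℕ
iverson b = if b then 1 else 0

sum-tabulate : ∀ {n} (f : Fin n → ℕ) → ListAction.sum (tabulate f) ≡ sum f
sum-tabulate {zero}  f = refl
sum-tabulate {suc n} f = cong (f zero +_) (sum-tabulate (f ∘ suc))

degree≡∑ : ∀ {n} (G : Graph n) u → degree G u ≡ ∑[ v < n ] iverson (adj G u v)
degree≡∑ {n} G u = trans (cong ListAction.sum (map-tabulate {n = n} id (iverson ∘ adj G u))) (sum-tabulate {n} _)

sum-zero : ∀ {n} {f : Fin n → ℕ} → (∀ i → f i ≡ 0) → sum f ≡ 0
sum-zero {n} f≡0 = trans (sum-cong-≗ f≡0) (sum-replicate-zero n)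

sum-ones : ∀ n → ∑[ i < n ] 1 ≡ n
sum-ones zero    = refl
sum-ones (suc n) = cong suc (sum-ones n)

sum-single : ∀ {n} (f : Fin n → ℕ) x → (∀ y → y ≢ x → f y ≡ 0) → sum f ≡ f x
sum-single f zero    f≡0 = trans (cong (f zero +_) (sum-zero λ y → f≡0 (suc y) λ ())) (+-identityʳ _)
sum-single f (suc x) f≡0 =
  cong₂ _+_ (f≡0 zero λ ()) (sum-single (f ∘ suc) x λ y y≢x → f≡0 (suc y) (y≢x ∘ suc-injective))

sum-≟ : ∀ {n} (x : Fin n) → ∑[ y < n ] iverson (does (y ≟ x)) ≡ 1
sum-≟ x = trans (sum-single _ x λ y y≢x → cong iverson (dec-false (y ≟ x) y≢x)) (cong iverson (dec-true (x ≟ x) refl))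

sum-↑ : ∀ a {b} (f : Fin (a + b) → ℕ) → sum f ≡ sum (f ∘ (_↑ˡ b)) + sum (f ∘ (a ↑ʳ_))
sum-↑ zero    f = refl
sum-↑ (suc a) f = trans (cong (f zero +_) (sum-↑ a (f ∘ suc))) (sym (+-assoc (f zero) _ _))

sum-combine : ∀ m {n} (f : Fin (m * n) → ℕ) → sum f ≡ ∑[ i < m ] ∑[ j < n ] f (combine i j)
sum-combine zero        f = refl
sum-combine (suc m) {n} f = trans (sum-↑ n f) (cong (sum (f ∘ (_↑ˡ (m * n))) +_) (sum-combine m (f ∘ (n ↑ʳ_))))

iverson-∨ : ∀ {A B : Set} (a? : Dec A) (b? : Dec B) → (A → B → ⊥) →
            iverson (does a? ∨ does b?) ≡ iverson (does a?) + iverson (does b?)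
iverson-∨ (yes a) (yes b) disjoint = ⊥-elim (disjoint a b)
iverson-∨ (yes a) (no _)  _        = refl
iverson-∨ (no _)  b?      _        = refl

injective⇒surjective : ∀ {m n} {f : Fin m → Fin (suc n)} → Injective _≡_ _≡_ f → suc n ≤ m →
                       ∀ j → ∃ λ i → f i ≡ j
injective⇒surjective {m} {n} {f} f-inj n<m j with any? (λ i → f i ≟ j)
... | yes hit  = hit
... | no  miss = contradiction n<m (≤⇒≯ (injective⇒≤ f/j-inj))
  where
  j≢f : ∀ i → j ≢ f i
  j≢f i j≡fi = miss (i , sym j≡fi)
  f/j : Fin m → Fin n
  f/j i = punchOut (j≢f i)
  f/j-inj : Injective _≡_ _≡_ f/j
  f/j-inj {x} {y} e = f-inj (punchOut-injective (j≢f x) (j≢f y) e)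

Isomorphic⇒≡ : ∀ {n m} (G : Graph n) (H : Graph m) → Isomorphic G H → n ≡ m
Isomorphic⇒≡ _ _ (φ , _) = cantor-schröder-bernstein (Bijection.injective φ) (Bijection.injective (sym-≡ φ))

-- The cyclic successor

next-fromℕ : ∀ {m} → next (fromℕ m) ≡ zero
next-fromℕ {m} with toℕ (fromℕ m) <? m
... | yes m<m = contradiction m<m (<-irrefl (toℕ-fromℕ m))
... | no _    = refl

next-inject₁ : ∀ {m} (i : Fin m) → next (inject₁ i) ≡ suc i
next-inject₁ {m} i with toℕ (inject₁ i) <? m
... | yes i<m = cong suc (toℕ-injective (trans (toℕ-fromℕ< i<m) (toℕ-inject₁ i)))
... | no i≮m  = contradiction (inject₁ℕ< i) i≮m

prev : ∀ {m} → Fin (suc m) → Fin (suc m)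
prev zero    = fromℕ _
prev (suc i) = inject₁ i

next-prev : ∀ {m} (i : Fin (suc m)) → next (prev i) ≡ i
next-prev zero    = next-fromℕ
next-prev (suc i) = next-inject₁ i

prev-next : ∀ {m} (i : Fin (suc m)) → prev (next i) ≡ i
prev-next i with view i
... | ‵fromℕ     = cong prev next-fromℕ
... | ‵inject₁ j = cong prev (next-inject₁ j)

next⇒prev : ∀ {m} {i j : Fin (suc m)} → i ≡ next j → j ≡ prev i
next⇒prev {j = j} i≡next = trans (sym (prev-next j)) (cong prev (sym i≡next))

prev⇒next : ∀ {m} {i j : Fin (suc m)} → j ≡ prev i → i ≡ next j
prev⇒next {i = i} j≡prev = trans (sym (next-prev i)) (cong next (sym j≡prev))

next≢id : ∀ {m} (i : Fin (2 + m)) → next i ≢ i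
next≢id i with view i
... | ‵fromℕ     = 0≢1+n ∘ trans (sym next-fromℕ)
... | ‵inject₁ j = λ e → 1+n≢n (trans (cong toℕ (trans (sym (next-inject₁ j)) e)) (toℕ-inject₁ j))

next≢prev : ∀ {m} (i : Fin (3 + m)) → next i ≢ prev i
next≢prev i with view i
... | ‵fromℕ     = 0≢1+n ∘ trans (sym next-fromℕ)
... | ‵inject₁ j = suc≢prev-inject₁ j ∘ trans (sym (next-inject₁ j))
  where
  suc≢prev-inject₁ : ∀ {m} (j : Fin (2 + m)) → suc j ≢ prev (inject₁ j)
  suc≢prev-inject₁ zero    = 0≢1+n ∘ suc-injective
  suc≢prev-inject₁ (suc j) e =
    m≢1+n+m (toℕ j) (sym (trans (cong toℕ e) (trans (toℕ-inject₁ (inject₁ j)) (toℕ-inject₁ j))))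

toℕ-next : ∀ {m} (i : Fin (suc m)) → toℕ (next i) ≡ suc (toℕ i) % suc m
toℕ-next {m} i with view i
... | ‵fromℕ     = trans (cong toℕ next-fromℕ)
                        (sym (trans (cong (λ t → suc t % suc m) (toℕ-fromℕ m)) (n%n≡0 (suc m))))
... | ‵inject₁ j = trans (cong toℕ (next-inject₁ j))
                        (sym (trans (m<n⇒m%n≡m (s≤s (inject₁ℕ< j))) (cong suc (toℕ-inject₁ j))))

toℕ-mod : ∀ t n .{{_ : NonZero n}} → toℕ (t mod n) ≡ t % n
toℕ-mod t n = toℕ-fromℕ< (m%n<n t n)

mod-toℕ : ∀ {m} (i : Fin (suc m)) → toℕ i mod suc m ≡ i
mod-toℕ i = toℕ-injective (trans (toℕ-mod (toℕ i) _) (m<n⇒m%n≡m (toℕ<n i)))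

mod-periodic : ∀ t n .{{_ : NonZero n}} → (t + n) mod n ≡ t mod n
mod-periodic t n = toℕ-injective (trans (toℕ-mod (t + n) n) (trans ([m+n]%n≡m%n t n) (sym (toℕ-mod t n))))

next-mod : ∀ {m} t → next (t mod suc m) ≡ suc t mod suc m
next-mod {m} t = toℕ-injective (begin
  toℕ (next (t mod n))     ≡⟨ toℕ-next (t mod n) ⟩
  suc (toℕ (t mod n)) % n  ≡⟨ cong (λ r → suc r % n) (toℕ-mod t n) ⟩
  (1 + t % n) % n          ≡⟨ %-distribˡ-+ 1 (t % n) n ⟩
  (1 % n + t % n % n) % n  ≡⟨ cong (λ r → (1 % n + r) % n) (m%n%n≡m%n t n) ⟩
  (1 % n + t % n) % n      ≡⟨ %-distribˡ-+ 1 t n ⟨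
  suc t % n                ≡⟨ toℕ-mod (suc t) n ⟨
  toℕ (suc t mod n)        ∎)
  where
  open ≡-Reasoning
  n : ℕ
  n = suc m

crossingℕ : ∀ {P : ℕ → Set} → Decidable P → ∀ {a b} → a ≤ b → P a → ¬ P b → ∃ λ t → P t × ¬ P (suc t)
crossingℕ P? {b = zero} z≤n pa ¬pb = contradiction pa ¬pb
crossingℕ {P} P? {a} {suc b} a≤1+b pa ¬p1+b with P? b
... | yes pb = b , pb , ¬p1+b
... | no ¬pb = crossingℕ P? (≤-pred (≤∧≢⇒< a≤1+b λ a≡1+b → ¬p1+b (subst P a≡1+b pa))) pa ¬pb

-- t ↦ P (t mod suc m) is periodic, so scanning ℕ from toℕ i up to toℕ j + suc m finds the crossing.
next-crossing : ∀ {m} {P : Fin (suc m) → Set} → Decidable P → ∀ {i j} → P i → ¬ P j →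
                ∃ λ k → P k × ¬ P (next k)
next-crossing {m} {P} P? {i} {j} pi ¬pj =
  let t , pt , ¬pt+1 = crossingℕ (P? ∘ (_mod suc m)) i≤j+m (subst P (sym (mod-toℕ i)) pi) ¬pj+m
  in  t mod suc m , pt , ¬pt+1 ∘ subst P (next-mod t)
  where
  i≤j+m : toℕ i ≤ toℕ j + suc m
  i≤j+m = ≤-trans (<⇒≤ (toℕ<n i)) (m≤n+m (suc m) (toℕ j))
  ¬pj+m : ¬ P ((toℕ j + suc m) mod suc m)
  ¬pj+m = ¬pj ∘ subst P (trans (mod-periodic (toℕ j) (suc m)) (mod-toℕ j))

-- Walks and cycles

_++ʷ_ : ∀ {n} {G : Graph n} {u v w} → Walk G u v → Walk G v w → Walk G u w
here       ++ʷ q = q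
step uw wv ++ʷ q = step uw (wv ++ʷ q)

reverseʷ : ∀ {n} {G : Graph n} {u v} → Walk G u v → Walk G v u
reverseʷ here                         = here
reverseʷ {G = G} (step {u} {w} uw wv) = reverseʷ wv ++ʷ step (trans (Graph.sym G w u) uw) here

connected-via : ∀ {n} {G : Graph n} c → (∀ u → Walk G u c) → Connected G
connected-via c reach u v = reach u ++ʷ reverseʷ (reach v)

module _ {n} {G : Graph n} where

  CycleEdge-sym : (C : Cycle G) → ∀ {u v} → CycleEdge C u v → CycleEdge C v u
  CycleEdge-sym C (i , inj₁ e) = i , inj₂ e
  CycleEdge-sym C (i , inj₂ e) = i , inj₁ e

  CycleEdge⇒adj : (C : Cycle G) → ∀ {u v} → CycleEdge C u v → adj G u v ≡ true
  CycleEdge⇒adj C (i , inj₁ (refl , refl)) = closed C i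
  CycleEdge⇒adj C (i , inj₂ (refl , refl)) = trans (Graph.sym G _ _) (closed C i)

  CycleEdge-ends : (C : Cycle G) → ∀ {u v} → CycleEdge C u v → (∃ λ i → vertex C i ≡ u) × (∃ λ i → vertex C i ≡ v)
  CycleEdge-ends C (i , inj₁ (i↦u , next↦v)) = (i , i↦u) , (next i , next↦v)
  CycleEdge-ends C (i , inj₂ (i↦v , next↦u)) = (next i , next↦u) , (i , i↦v)

  cycle-neighbour : (C : Cycle G) → ∀ i {w} → CycleEdge C (vertex C i) w →
                    w ≡ vertex C (next i) ⊎ w ≡ vertex C (prev i)
  cycle-neighbour C i (k , inj₁ (k↦i , next↦w)) =
    inj₁ (trans (sym next↦w) (cong (vertex C ∘ next) (inj C k↦i)))
  cycle-neighbour C i (k , inj₂ (k↦w , next↦i)) =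
    inj₂ (trans (sym k↦w) (cong (vertex C) (next⇒prev (sym (inj C next↦i)))))

  SameCycle-⊆ : (C D : Cycle G) → (∀ {u v} → CycleEdge D u v → CycleEdge C u v) →
                (∀ i → ∃ λ x → vertex D x ≡ vertex C i) → SameCycle C D
  SameCycle-⊆ C D D⊆C covers u v = C⊆D , D⊆C
    where
    c : Fin (len C) → Fin n
    c = vertex C
    d : Fin (len D) → Fin n
    d = vertex D

    -- The two D-neighbours of c i are distinct C-neighbours of c i, so one of them is c (next i).
    forward : ∀ i → CycleEdge D (c i) (c (next i))
    forward i with covers i
    ... | x , dx≡ci with cycle-neighbour C i (subst (λ w → CycleEdge C w (d (next x))) dx≡ci
                                                   (D⊆C (x , inj₁ (refl , refl))))
    ...   | inj₁ dnx≡cni = x , inj₁ (dx≡ci , dnx≡cni)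
    ...   | inj₂ dnx≡cpi with cycle-neighbour C i (subst (λ w → CycleEdge C w (d (prev x))) dx≡ci
                                                     (D⊆C (prev x , inj₂ (refl , cong d (next-prev x)))))
    ...     | inj₁ dpx≡cni = prev x , inj₂ (dpx≡cni , trans (cong d (next-prev x)) dx≡ci)
    ...     | inj₂ dpx≡cpi = ⊥-elim (next≢prev x (inj D (trans dnx≡cpi (sym dpx≡cpi))))

    C⊆D : ∀ {u v} → CycleEdge C u v → CycleEdge D u v
    C⊆D (i , inj₁ (refl , refl)) = forward i
    C⊆D (i , inj₂ (refl , refl)) = CycleEdge-sym D (forward i)

  cycle-confined : ∀ {B : Fin n → Set} → Decidable B → ∀ r →
                   (∀ {u v} → B u → ¬ B v → adj G u v ≡ true → u ≡ r) →
                   (D : Cycle G) → ∀ x → B (vertex D x) → vertex D x ≢ r → ∀ y → B (vertex D y)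
  -- Leaving B and entering B ∖ {r} both happen at r, which D visits only once.
  cycle-confined {B} B? r leaves-at-r D x inB x≢r y = decidable-stable (B? (v y)) λ ∉B →
    let k , inBk , ∉Bk+1 = next-crossing (B? ∘ v) inB ∉B
        k′ , ¬inner , ¬¬inner′ = next-crossing (¬? ∘ Inner? ∘ v) (∉B ∘ proj₁) (λ ¬inner → ¬inner (inB , x≢r))
        inB′ , ≢r = decidable-stable (Inner? (v (next k′))) ¬¬inner′
        k≡k′ = inj D (trans (leaves-at-r inBk ∉Bk+1 (closed D k)) (sym (entered-at-r k′ ¬inner inB′ ≢r)))
    in  ∉Bk+1 (subst (B ∘ v ∘ next) (sym k≡k′) inB′)
    where
    v : Fin (len D) → Fin n
    v = vertex D
    Inner : Fin n → Set
    Inner u = B u × u ≢ r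
    Inner? : Decidable Inner
    Inner? u = B? u ×-dec ¬? (u ≟ r)
    entered-at-r : ∀ k → ¬ Inner (v k) → B (v (next k)) → v (next k) ≢ r → v k ≡ r
    entered-at-r k ¬inner inB′ ≢r with B? (v k)
    ... | yes inBk = decidable-stable (v k ≟ r) (λ ≢r′ → ¬inner (inBk , ≢r′))
    ... | no ∉Bk   = contradiction (leaves-at-r inB′ ∉Bk (trans (Graph.sym G _ _) (closed D k))) ≢r

-- Cycle graphs

cycleGraph : ∀ q → Graph (3 + q)
cycleGraph q = record
  { adj    = λ i j → does (j ≟ next i) ∨ does (i ≟ next j)
  ; sym    = λ i j → ∨-comm (does (j ≟ next i)) (does (i ≟ next j))
  ; irrefl = λ i → cong (λ b → b ∨ b) (dec-false (i ≟ next i) (next≢id i ∘ sym))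
  }

module _ {q : ℕ} where

  cycleGraph-adj-next : ∀ i → adj (cycleGraph q) i (next i) ≡ true
  cycleGraph-adj-next i = cong (_∨ does (i ≟ next (next i))) (dec-true (next i ≟ next i) refl)

  cycleGraph-adj⇒ : ∀ {i j} → adj (cycleGraph q) i j ≡ true → j ≡ next i ⊎ j ≡ prev i
  cycleGraph-adj⇒ {i} {j} adjacent with j ≟ next i | i ≟ next j
  ... | yes j≡next | _          = inj₁ j≡next
  ... | no _       | yes i≡next = inj₂ (next⇒prev i≡next)
  ... | no _       | no _       = contradiction adjacent λ ()

  cycleGraph-regular : Regular 2 (cycleGraph q)
  cycleGraph-regular i = begin
    degree (cycleGraph q) i
      ≡⟨ degree≡∑ (cycleGraph q) i ⟩
    ∑[ j < 3 + q ] iverson (does (j ≟ next i) ∨ does (i ≟ next j))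
      ≡⟨ sum-cong-≗ split ⟩
    ∑[ j < 3 + q ] (iverson (does (j ≟ next i)) + iverson (does (j ≟ prev i)))
      ≡⟨ ∑-distrib-+ (λ j → iverson (does (j ≟ next i))) (λ j → iverson (does (j ≟ prev i))) ⟩
    ∑[ j < 3 + q ] iverson (does (j ≟ next i)) + ∑[ j < 3 + q ] iverson (does (j ≟ prev i))
      ≡⟨ cong₂ _+_ (sum-≟ (next i)) (sum-≟ (prev i)) ⟩
    2 ∎
    where
    open ≡-Reasoning
    split : ∀ j → iverson (does (j ≟ next i) ∨ does (i ≟ next j))
                ≡ iverson (does (j ≟ next i)) + iverson (does (j ≟ prev i))
    split j = trans (iverson-∨ (j ≟ next i) (i ≟ next j)
                               λ j≡next i≡next → next≢prev i (trans (sym j≡next) (next⇒prev i≡next)))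
                    (cong (λ b → iverson (does (j ≟ next i)) + iverson b)
                          (does-⇔ (mk⇔ next⇒prev prev⇒next) (i ≟ next j) (j ≟ prev i)))

  cycleGraph-connected : Connected (cycleGraph q)
  cycleGraph-connected = connected-via zero λ i →
    reverseʷ (subst (Walk (cycleGraph q) zero) (mod-toℕ i) (from-zero (toℕ i)))
    where
    from-zero : ∀ t → Walk (cycleGraph q) zero (t mod (3 + q))
    from-zero zero    = here
    from-zero (suc t) = from-zero t ++ʷ step (subst (λ j → adj (cycleGraph q) (t mod (3 + q)) j ≡ true)
                                                    (next-mod t) (cycleGraph-adj-next (t mod (3 + q)))) here

  spanningCycle : Cycle (cycleGraph q)
  spanningCycle = record { l = q ; vertex = id ; inj = id ; closed = cycleGraph-adj-next }

  cycleGraph-edge : ∀ {i j} → adj (cycleGraph q) i j ≡ true → CycleEdge spanningCycle i j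
  cycleGraph-edge {i} {j} adjacent with cycleGraph-adj⇒ adjacent
  ... | inj₁ j≡next = i , inj₁ (refl , sym j≡next)
  ... | inj₂ j≡prev = j , inj₂ (refl , sym (prev⇒next j≡prev))

-- Rooted products

combine-elim : ∀ {m n} {P : Fin (m * n) → Set} → (∀ i j → P (combine i j)) → ∀ u → P u
combine-elim {m} {n} {P} p u = let i , j , eq = combine-surjective {m} {n} u in subst P eq (p i j)

remQuot-injective : ∀ {m} n {u v : Fin (m * n)} → remQuot {m} n u ≡ remQuot n v → u ≡ v
remQuot-injective {m} n {u} {v} eq =
  trans (sym (combine-remQuot {m} n u)) (trans (cong (uncurry (combine {m} {n})) eq) (combine-remQuot {m} n v))

isRoot : ∀ {s} → Fin (suc s) → Bool
isRoot zero    = true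
isRoot (suc _) = false

isRoot∧⇒≡zero : ∀ {s} (a : Fin (suc s)) b → isRoot a ∧ b ≡ true → a ≡ zero
isRoot∧⇒≡zero zero _ _ = refl

-- combine j a is the vertex a of the j-th copy of H; distinct copies are joined only at their
-- roots (vertex zero), along the edges of R.
productAdj : ∀ {m s} → Graph m → Graph (suc s) → Fin m × Fin (suc s) → Fin m × Fin (suc s) → Bool
productAdj R H (j , a) (j′ , b) = if does (j ≟ j′) then adj H a b else isRoot a ∧ isRoot b ∧ adj R j j′

rootedProduct : ∀ {m s} → Graph m → Graph (suc s) → Graph (m * suc s)
rootedProduct {m} {s} R H = record
  { adj    = λ u v → productAdj R H (remQuot {m} (suc s) u) (remQuot {m} (suc s) v)
  ; sym    = λ u v → productAdj-sym (remQuot {m} (suc s) u) (remQuot {m} (suc s) v)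
  ; irrefl = λ u → productAdj-irrefl (remQuot {m} (suc s) u)
  }
  where
  roots-sym : ∀ j j′ a b → isRoot a ∧ isRoot b ∧ adj R j j′ ≡ isRoot b ∧ isRoot a ∧ adj R j′ j
  roots-sym j j′ zero    zero    = Graph.sym R j j′
  roots-sym j j′ zero    (suc _) = refl
  roots-sym j j′ (suc _) zero    = refl
  roots-sym j j′ (suc _) (suc _) = refl

  productAdj-sym : ∀ x y → productAdj R H x y ≡ productAdj R H y x
  productAdj-sym (j , a) (j′ , b) with j ≟ j′ | j′ ≟ j
  ... | yes refl | yes _    = Graph.sym H a b
  ... | yes j≡j′ | no j′≢j  = contradiction (sym j≡j′) j′≢j
  ... | no j≢j′  | yes j′≡j = contradiction (sym j′≡j) j≢j′
  ... | no _     | no _     = roots-sym j j′ a b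

  productAdj-irrefl : ∀ x → productAdj R H x x ≡ false
  productAdj-irrefl (j , a) with j ≟ j
  ... | yes _   = Graph.irrefl H a
  ... | no j≢j  = contradiction refl j≢j

module RootedProduct {m s : ℕ} (R : Graph m) (H : Graph (suc s)) where

  G : Graph (m * suc s)
  G = rootedProduct R H

  copyOf : Fin (m * suc s) → Fin m
  copyOf u = proj₁ (remQuot {m} (suc s) u)

  inH : Fin (m * suc s) → Fin (suc s)
  inH u = proj₂ (remQuot {m} (suc s) u)

  root : Fin m → Fin (m * suc s)
  root j = combine j zero

  inH-root : ∀ j → inH (root j) ≡ zero
  inH-root j = cong proj₂ (remQuot-combine {m} j zero)

  inH≡zero⇒root : ∀ {u} → inH u ≡ zero → u ≡ root (copyOf u)
  inH≡zero⇒root {u} on-root = trans (sym (combine-remQuot {m} (suc s) u)) (cong (combine (copyOf u)) on-root)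

  copyOf-inH-injective : ∀ {u v} → copyOf u ≡ copyOf v → inH u ≡ inH v → u ≡ v
  copyOf-inH-injective same-copy same-inH = remQuot-injective {m} (suc s) (cong₂ _,_ same-copy same-inH)

  adj-combine : ∀ j a j′ b → adj G (combine j a) (combine j′ b) ≡ productAdj R H (j , a) (j′ , b)
  adj-combine j a j′ b = cong₂ (productAdj R H) (remQuot-combine {m} j a) (remQuot-combine {m} j′ b)

  productAdj-same : ∀ j a b → productAdj R H (j , a) (j , b) ≡ adj H a b
  productAdj-same j a b = cong (if_then adj H a b else _) (dec-true (j ≟ j) refl)

  productAdj-other : ∀ {j j′} a b → j ≢ j′ → productAdj R H (j , a) (j′ , b) ≡ isRoot a ∧ isRoot b ∧ adj R j j′
  productAdj-other {j} {j′} a b j≢j′ = cong (if_then adj H a b else _) (dec-false (j ≟ j′) j≢j′)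

  adj-root : ∀ i j → adj G (root i) (root j) ≡ adj R i j
  adj-root i j with i ≟ j
  ... | yes refl = trans (adj-combine i zero i zero) (trans (productAdj-same i zero zero)
                         (trans (Graph.irrefl H zero) (sym (Graph.irrefl R i))))
  ... | no i≢j   = trans (adj-combine i zero j zero) (productAdj-other zero zero i≢j)

  root-injective : ∀ {i j} → root i ≡ root j → i ≡ j
  root-injective {i} {j} = combine-injectiveˡ i zero j zero

  degree-combine : ∀ j a → degree G (combine j a) ≡ degree H a + (if isRoot a then degree R j else 0)
  degree-combine j a = begin
    degree G (combine j a)
      ≡⟨ degree≡∑ G (combine j a) ⟩
    ∑[ u < m * suc s ] iverson (adj G (combine j a) u)
      ≡⟨ sum-combine m {suc s} (iverson ∘ adj G (combine j a)) ⟩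
    ∑[ j′ < m ] ∑[ b < suc s ] iverson (adj G (combine j a) (combine j′ b))
      ≡⟨ sum-cong-≗ (λ j′ → sum-cong-≗ (cong iverson ∘ adj-combine j a j′)) ⟩
    ∑[ j′ < m ] ∑[ b < suc s ] iverson (productAdj R H (j , a) (j′ , b))
      ≡⟨ sum-cong-≗ row ⟩
    ∑[ j′ < m ] (own j′ + iverson (isRoot a ∧ adj R j j′))
      ≡⟨ ∑-distrib-+ own _ ⟩
    ∑[ j′ < m ] own j′ + ∑[ j′ < m ] iverson (isRoot a ∧ adj R j j′)
      ≡⟨ cong₂ _+_ own-copy (root-edges a) ⟩
    degree H a + (if isRoot a then degree R j else 0) ∎
    where
    open ≡-Reasoning
    own : Fin m → ℕ
    own j′ = if does (j′ ≟ j) then degree H a else 0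

    row : ∀ j′ → ∑[ b < suc s ] iverson (productAdj R H (j , a) (j′ , b)) ≡ own j′ + iverson (isRoot a ∧ adj R j j′)
    row j′ with j′ ≟ j
    ... | yes refl = begin
      ∑[ b < suc s ] iverson (productAdj R H (j , a) (j , b))
        ≡⟨ sum-cong-≗ (cong iverson ∘ productAdj-same j a) ⟩
      ∑[ b < suc s ] iverson (adj H a b)
        ≡⟨ degree≡∑ H a ⟨
      degree H a
        ≡⟨ +-identityʳ _ ⟨
      degree H a + 0
        ≡⟨ cong (λ e → degree H a + iverson e) (∧-zeroʳ (isRoot a)) ⟨
      degree H a + iverson (isRoot a ∧ false)
        ≡⟨ cong (λ e → degree H a + iverson (isRoot a ∧ e)) (Graph.irrefl R j) ⟨
      degree H a + iverson (isRoot a ∧ adj R j j) ∎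
    ... | no j′≢j  = trans (sum-cong-≗ (λ b → cong iverson (productAdj-other a b (j′≢j ∘ sym))))
                           (sum-single (λ b → iverson (isRoot a ∧ isRoot {s} b ∧ adj R j j′)) zero λ where
                             zero    zero≢zero → contradiction refl zero≢zero
                             (suc _) _         → cong iverson (∧-zeroʳ (isRoot a)))

    own-copy : ∑[ j′ < m ] own j′ ≡ degree H a
    own-copy = trans (sum-single own j λ j′ j′≢j → cong (if_then degree H a else 0) (dec-false (j′ ≟ j) j′≢j))
                     (cong (if_then degree H a else 0) (dec-true (j ≟ j) refl))

    root-edges : ∀ a → ∑[ j′ < m ] iverson (isRoot a ∧ adj R j j′) ≡ (if isRoot a then degree R j else 0)
    root-edges zero    = sym (degree≡∑ R j)
    root-edges (suc _) = sum-zero {m} λ _ → refl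

  rootedProduct-regular : ∀ {d k} → Regular d R → degree H zero + d ≡ k → (∀ a → degree H (suc a) ≡ k) → Regular k G
  rootedProduct-regular R-regular root-degree nonroot-degree = combine-elim {m} λ where
    j zero    → trans (degree-combine j zero) (trans (cong (degree H zero +_) (R-regular j)) root-degree)
    j (suc a) → trans (degree-combine j (suc a)) (trans (+-identityʳ _) (nonroot-degree a))

  liftH : ∀ j {a b} → Walk H a b → Walk G (combine j a) (combine j b)
  liftH j here                 = here
  liftH j (step {a} {w} aw wb) = step (trans (adj-combine j a j w) (trans (productAdj-same j a w) aw)) (liftH j wb)

  liftR : ∀ {i j} → Walk R i j → Walk G (root i) (root j)
  liftR here                 = here
  liftR (step {i} {w} iw wj) = step (trans (adj-root i w) iw) (liftR wj)

  rootedProduct-connected : Connected R → (∀ a → Walk H a zero) → Connected G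
  rootedProduct-connected R-connected reaches-root u v =
    to-root u ++ʷ (liftR (R-connected (copyOf u) (copyOf v)) ++ʷ reverseʷ (to-root v))
    where
    to-root : ∀ u → Walk G u (root (copyOf u))
    to-root u = subst (λ w → Walk G w (root (copyOf u))) (combine-remQuot {m} (suc s) u)
                      (liftH (copyOf u) (reaches-root (inH u)))

  liftCycle : Cycle R → Cycle G
  liftCycle C = record
    { l      = l C
    ; vertex = root ∘ vertex C
    ; inj    = inj C ∘ root-injective
    ; closed = λ i → trans (adj-root _ _) (closed C i)
    }

  CycleEdge-liftCycle : (C : Cycle R) → ∀ {a b} → CycleEdge C a b → CycleEdge (liftCycle C) (root a) (root b)
  CycleEdge-liftCycle C (i , inj₁ (i↦a , next↦b)) = i , inj₁ (cong root i↦a , cong root next↦b)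
  CycleEdge-liftCycle C (i , inj₂ (i↦b , next↦a)) = i , inj₂ (cong root i↦b , cong root next↦a)

  leaves-copy-at-root : ∀ {j u v} → copyOf u ≡ j → copyOf v ≢ j → adj G u v ≡ true → u ≡ root j
  leaves-copy-at-root {u = u} refl v∉j adjacent =
    inH≡zero⇒root (isRoot∧⇒≡zero (inH u) _ (trans (sym (productAdj-other (inH u) _ (v∉j ∘ sym))) adjacent))

  in-one-copy-or-on-roots : (D : Cycle G) → (∃ λ j → ∀ x → copyOf (vertex D x) ≡ j) ⊎ (∀ x → inH (vertex D x) ≡ zero)
  in-one-copy-or-on-roots D with all? (λ x → inH (vertex D x) ≟ zero)
  ... | yes on-roots = inj₂ on-roots
  ... | no ¬on-roots =
    let x , off-root = ¬∀⟶∃¬ _ _ (λ x → inH (vertex D x) ≟ zero) ¬on-roots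
        j = copyOf (vertex D x)
    in  inj₁ (j , cycle-confined (λ u → copyOf u ≟ j) (root j) leaves-copy-at-root D x refl
                                 (λ x↦root → off-root (trans (cong inH x↦root) (inH-root j))))

  in-one-copy⇒len≤ : (D : Cycle G) → ∀ {j} → (∀ x → copyOf (vertex D x) ≡ j) → len D ≤ suc s
  in-one-copy⇒len≤ D in-j = injective⇒≤ {f = inH ∘ vertex D} λ same-inH →
    inj D (copyOf-inH-injective (trans (in-j _) (sym (in-j _))) same-inH)

  on-roots⇒copyOf-injective : (D : Cycle G) → (∀ x → inH (vertex D x) ≡ zero) →
                              Injective _≡_ _≡_ (copyOf ∘ vertex D)
  on-roots⇒copyOf-injective D on-roots same-copy =
    inj D (copyOf-inH-injective same-copy (trans (on-roots _) (sym (on-roots _))))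

module RingOfCopies {q s : ℕ} (H : Graph (suc s)) (H<ring : suc s < 3 + q) where
  open RootedProduct (cycleGraph q) H

  rootCycle : Cycle G
  rootCycle = liftCycle spanningCycle

  rootCycle-longest : Longest rootCycle
  rootCycle-longest D with in-one-copy-or-on-roots D
  ... | inj₁ (_ , in-j) = ≤-trans (in-one-copy⇒len≤ D in-j) (<⇒≤ H<ring)
  ... | inj₂ on-roots   = injective⇒≤ (on-roots⇒copyOf-injective D on-roots)

  module _ (D : Cycle G) (on-roots : ∀ x → inH (vertex D x) ≡ zero) where

    on-root : ∀ {u} → (∃ λ x → vertex D x ≡ u) → u ≡ root (copyOf u)
    on-root (x , refl) = inH≡zero⇒root (on-roots x)

    on-roots-edge : ∀ {u v} → CycleEdge D u v → CycleEdge rootCycle u v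
    on-roots-edge {u} {v} u~v =
      let u-root , v-root = Product.map on-root on-root (CycleEdge-ends D u~v)
          adjacent = trans (sym (adj-root (copyOf u) (copyOf v)))
                           (subst₂ (λ u′ v′ → adj G u′ v′ ≡ true) u-root v-root (CycleEdge⇒adj D u~v))
      in  subst₂ (CycleEdge rootCycle) (sym u-root) (sym v-root)
                 (CycleEdge-liftCycle spanningCycle (cycleGraph-edge {i = copyOf u} {copyOf v} adjacent))

    covers-roots : len rootCycle ≤ len D → ∀ i → ∃ λ x → vertex D x ≡ root i
    covers-roots long i =
      let x , x↦i = injective⇒surjective (on-roots⇒copyOf-injective D on-roots) long i
      in  x , trans (on-root (x , refl)) (cong root x↦i)

  rootCycle-unique : ∀ D → Longest D → SameCycle rootCycle D
  rootCycle-unique D longest with in-one-copy-or-on-roots D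
  ... | inj₁ (_ , in-j) = contradiction (≤-trans (longest rootCycle) (in-one-copy⇒len≤ D in-j)) (<⇒≱ H<ring)
  ... | inj₂ on-roots   =
    SameCycle-⊆ rootCycle D (on-roots-edge D on-roots) (covers-roots D on-roots (longest rootCycle))

  uniqueLongestCycle : UniqueLongestCycle G
  uniqueLongestCycle = rootCycle , rootCycle-longest , rootCycle-unique

-- Gadgets

record Gadget (k : ℕ) : Set where
  field
    s              : ℕ
    H              : Graph (suc s)
    degree-root    : degree H zero + 2 ≡ k
    degree-nonroot : ∀ a → degree H (suc a) ≡ k
    reaches-root   : ∀ a → Walk H a zero

pointGadget : Gadget 2
pointGadget = record
  { s              = 0
  ; H              = record { adj = λ _ _ → false ; sym = λ _ _ → refl ; irrefl = λ _ → refl }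
  ; degree-root    = refl
  ; degree-nonroot = λ ()
  ; reaches-root   = λ { zero → here }
  }

cubicEdge : ℕ → ℕ → Bool
cubicEdge 0 1 = true
cubicEdge 1 2 = true
cubicEdge 1 3 = true
cubicEdge 2 4 = true
cubicEdge 2 5 = true
cubicEdge 3 4 = true
cubicEdge 3 5 = true
cubicEdge 4 5 = true
cubicEdge _ _ = false

cubicGadget : Gadget 3
cubicGadget = record
  { s              = 5
  ; H              = H₆
  ; degree-root    = refl
  ; degree-nonroot = λ { 0F → refl ; 1F → refl ; 2F → refl ; 3F → refl ; 4F → refl }
  ; reaches-root   = λ where
      0F → here
      1F → step refl here
      2F → step {w = 1F} refl (step refl here)
      3F → step {w = 1F} refl (step refl here)
      4F → step {w = 2F} refl (step {w = 1F} refl (step refl here))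
      5F → step {w = 2F} refl (step {w = 1F} refl (step refl here))
  }
  where
  H₆ : Graph 6
  H₆ = record
    { adj    = λ u v → cubicEdge (toℕ u) (toℕ v) ∨ cubicEdge (toℕ v) (toℕ u)
    ; sym    = λ u v → ∨-comm (cubicEdge (toℕ u) (toℕ v)) _
    ; irrefl = λ { 0F → refl ; 1F → refl ; 2F → refl ; 3F → refl ; 4F → refl ; 5F → refl }
    }

module Cone (a : ℕ) {b : ℕ} (K : Graph b) where

  isLeft : Fin a ⊎ Fin b → Bool
  isLeft (inj₁ _) = true
  isLeft (inj₂ _) = false

  sideAdj : Fin a ⊎ Fin b → Fin a ⊎ Fin b → Bool
  sideAdj (inj₁ _) (inj₁ _)  = false
  sideAdj (inj₁ _) (inj₂ _)  = true
  sideAdj (inj₂ _) (inj₁ _)  = true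
  sideAdj (inj₂ y) (inj₂ y′) = adj K y y′

  coneAdj : Fin (suc (a + b)) → Fin (suc (a + b)) → Bool
  coneAdj zero    zero     = false
  coneAdj zero    (suc i)  = isLeft (splitAt a i)
  coneAdj (suc i) zero     = isLeft (splitAt a i)
  coneAdj (suc i) (suc i′) = sideAdj (splitAt a i) (splitAt a i′)

  cone : Graph (suc (a + b))
  cone = record { adj = coneAdj ; sym = coneAdj-sym ; irrefl = coneAdj-irrefl }
    where
    sideAdj-sym : ∀ p p′ → sideAdj p p′ ≡ sideAdj p′ p
    sideAdj-sym (inj₁ _) (inj₁ _)  = refl
    sideAdj-sym (inj₁ _) (inj₂ _)  = refl
    sideAdj-sym (inj₂ _) (inj₁ _)  = refl
    sideAdj-sym (inj₂ y) (inj₂ y′) = Graph.sym K y y′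

    coneAdj-sym : ∀ u v → coneAdj u v ≡ coneAdj v u
    coneAdj-sym zero    zero     = refl
    coneAdj-sym zero    (suc i)  = refl
    coneAdj-sym (suc i) zero     = refl
    coneAdj-sym (suc i) (suc i′) = sideAdj-sym (splitAt a i) (splitAt a i′)

    coneAdj-irrefl : ∀ u → coneAdj u u ≡ false
    coneAdj-irrefl zero    = refl
    coneAdj-irrefl (suc i) with splitAt a i
    ... | inj₁ _ = refl
    ... | inj₂ y = Graph.irrefl K y

  sideDegree : Fin a ⊎ Fin b → ℕ
  sideDegree (inj₁ _) = suc b
  sideDegree (inj₂ y) = a + degree K y

  sum-cone : (f : Fin (suc (a + b)) → ℕ) →
             sum f ≡ f zero + (∑[ x < a ] f (suc (x ↑ˡ b)) + ∑[ y < b ] f (suc (a ↑ʳ y)))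
  sum-cone f = cong (f zero +_) (sum-↑ a (f ∘ suc))

  degree-apex : degree cone zero ≡ a
  degree-apex = begin
    degree cone zero
      ≡⟨ degree≡∑ cone zero ⟩
    ∑[ v < suc (a + b) ] iverson (coneAdj zero v)
      ≡⟨ sum-cone (iverson ∘ coneAdj zero) ⟩
    ∑[ x < a ] iverson (isLeft (splitAt a (x ↑ˡ b))) + ∑[ y < b ] iverson (isLeft (splitAt a (a ↑ʳ y)))
      ≡⟨ cong₂ _+_ (sum-cong-≗ λ x → cong (iverson ∘ isLeft) (splitAt-↑ˡ a x b))
                   (sum-zero λ y → cong (iverson ∘ isLeft) (splitAt-↑ʳ a b y)) ⟩
    ∑[ x < a ] 1 + 0
      ≡⟨ +-identityʳ _ ⟩
    ∑[ x < a ] 1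
      ≡⟨ sum-ones a ⟩
    a ∎
    where open ≡-Reasoning

  degree-side : ∀ i → degree cone (suc i) ≡ sideDegree (splitAt a i)
  degree-side i = trans (degree≡∑ cone (suc i)) (trans (sum-cone (iverson ∘ coneAdj (suc i))) (side (splitAt a i)))
    where
    side : ∀ p → iverson (isLeft p) + (∑[ x < a ] iverson (sideAdj p (splitAt a (x ↑ˡ b)))
                                     + ∑[ y < b ] iverson (sideAdj p (splitAt a (a ↑ʳ y))))
               ≡ sideDegree p
    side p rewrite sum-cong-≗ (λ x → cong (iverson ∘ sideAdj p) (splitAt-↑ˡ a x b))
                 | sum-cong-≗ (λ y → cong (iverson ∘ sideAdj p) (splitAt-↑ʳ a b y)) with p
    ... | inj₁ _ = cong suc (cong₂ _+_ (sum-zero {a} λ _ → refl) (sum-ones b))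
    ... | inj₂ y = cong₂ _+_ (sum-ones a) (sym (degree≡∑ K y))

  reaches-apex : Fin a → ∀ v → Walk cone v zero
  reaches-apex x₀ zero    = here
  reaches-apex x₀ (suc i) with splitAt a i in split-i
  ... | inj₁ _ = step (cong isLeft split-i) here
  ... | inj₂ _ = step {w = suc (x₀ ↑ˡ b)} (cong₂ sideAdj split-i (splitAt-↑ˡ a x₀ b))
                      (step (cong isLeft (splitAt-↑ˡ a x₀ b)) here)

coneGadget : ∀ t → Gadget (4 + t)
coneGadget t = record
  { s              = (2 + t) + (3 + t)
  ; H              = cone
  ; degree-root    = trans (cong (_+ 2) degree-apex) (+-comm (2 + t) 2)
  ; degree-nonroot = λ i → trans (degree-side i) (sideDegree≡ (splitAt (2 + t) i))
  ; reaches-root   = reaches-apex zero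
  }
  where
  open Cone (2 + t) (cycleGraph t)
  sideDegree≡ : ∀ p → sideDegree p ≡ 4 + t
  sideDegree≡ (inj₁ _) = refl
  sideDegree≡ (inj₂ y) = trans (cong ((2 + t) +_) (cycleGraph-regular y)) (+-comm (2 + t) 2)

gadget : ∀ k → 2 ≤ k → Gadget k
gadget 1                         (s≤s ())
gadget 2                         _ = pointGadget
gadget 3                         _ = cubicGadget
gadget (suc (suc (suc (suc t)))) _ = coneGadget t

module Family {k : ℕ} (Γ : Gadget k) where
  open Gadget Γ

  member : ℕ → SomeGraph
  member i = mkGraph _ (rootedProduct (cycleGraph (s + i)) H)

  member-connected : ∀ i → Connected (graph (member i))
  member-connected i =
    RootedProduct.rootedProduct-connected (cycleGraph (s + i)) H cycleGraph-connected reaches-root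

  member-regular : ∀ i → Regular k (graph (member i))
  member-regular i =
    RootedProduct.rootedProduct-regular (cycleGraph (s + i)) H cycleGraph-regular degree-root degree-nonroot

  member-uniqueLongestCycle : ∀ i → UniqueLongestCycle (graph (member i))
  member-uniqueLongestCycle i = RingOfCopies.uniqueLongestCycle H (s≤s (s≤s (m≤n⇒m≤1+n (m≤m+n s i))))

  member-nonisomorphic : ∀ i j → i ≢ j → ¬ Isomorphic (graph (member i)) (graph (member j))
  member-nonisomorphic i j i≢j iso =
    i≢j (+-cancelˡ-≡ (3 + s) i j (*-cancelʳ-≡ _ _ (suc s) (Isomorphic⇒≡ (graph (member i)) (graph (member j)) iso)))

proposition4 : (k : ℕ) → 2 ≤ k →
    Σ (ℕ → SomeGraph) λ G →
      (∀ i → Connected (graph (G i))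
           × Regular k (graph (G i))
           × UniqueLongestCycle (graph (G i)))
      × (∀ i j → ¬ i ≡ j → ¬ Isomorphic (graph (G i)) (graph (G j)))
proposition4 k 2≤k =
  member , (λ i → member-connected i , member-regular i , member-uniqueLongestCycle i) , member-nonisomorphic
  where open Family (gadget k 2≤k)
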